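{- Let $\gamma_{2,2,2} = 7,6,4,3,5,2,1 \in S_7$. For all $n \ge 5$, $$|S_n(132, 123, \gamma_{2,2,2})| = 5 F_{n+1} - 9n + 21,$$ and $$\sum_{n=0}^\infty |S_n(132, 123, \gamma_{2,2,2})| x^n = -25 - 16x - 11x^2 - 5 x^3 - 2x^4 + \frac{30x^3+14x^2-61x+26}{(1-x)^2(1-x-x^2)}.$$
   Context: $S_n$ is the set of permutations of $\{1,\dots,n\}$ in one-line notation; $\pi$ avoids $\sigma\in S_k$ if no subsequence of $\pi$ of length $k$ has the same relative order as $\sigma$; $S_n(R)$ is the set of $\pi\in S_n$ avoiding every element of $R$, and $S_0(R)$ contains only the empty permutation. $F_n$ denotes the Fibonacci numbers, $F_0=0$, $F_1=1$, $F_n=F_{n-1}+F_{n-2}$. -}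

module Defs where

open import Data.Nat using (ℕ; zero; suc)
open import Data.Integer as ℤ using (ℤ; +_; -[1+_])
open import Data.Fin using (Fin; #_) renaming (_<_ to _<ᶠ_)
open import Data.Vec using (Vec; []; _∷_; lookup)
open import Data.List using (List; length; []; _∷_)
open import Data.List.Relation.Unary.All using (All)
open import Data.List.Relation.Unary.Unique.Propositional using (Unique)
open import Data.List.Membership.Propositional using (_∈_)
open import Data.Product using (Σ; ∃; _×_)
open import Function.Bundles using (_⇔_)
open import Function.Definitions using (Injective)
open import Relation.Binary.PropositionalEquality using (_≡_)
open import Relation.Nullary using (¬_)

F : ℕ → ℕ
F zero = 0
F (suc zero) = 1
F (suc (suc n)) = F (suc n) Data.Nat.+ F n

-- A permutation of size n in one-line notation: a vector of n values in
-- Fin n (values 0..n-1 instead of 1..n), i ↦ lookup π i injective.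
Perm : ℕ → Set
Perm n = Vec (Fin n) n

IsPerm : ∀ {n} → Perm n → Set
IsPerm π = Injective _≡_ _≡_ (lookup π)

Contains : ∀ {n k} → Perm n → Perm k → Set
Contains {n} {k} π σ =
  Σ (Fin k → Fin n) λ f →
    (∀ i j → i <ᶠ j → f i <ᶠ f j) ×
    (∀ i j → (lookup π (f i) <ᶠ lookup π (f j)) ⇔ (lookup σ i <ᶠ lookup σ j))

Avoids : ∀ {n k} → Perm n → Perm k → Set
Avoids π σ = ¬ Contains π σ

Pattern : Set
Pattern = Σ ℕ Perm

AvoidsAll : ∀ {n} → List Pattern → Perm n → Set
AvoidsAll R π = All (λ p → Avoids π (Data.Product.proj₂ p)) R

InS : ∀ {n} → List Pattern → Perm n → Set
InS R π = IsPerm π × AvoidsAll R π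

HasCard : {A : Set} → (A → Set) → ℕ → Set
HasCard {A} P k =
  Σ (List A) λ L → Unique L × (∀ x → (x ∈ L) ⇔ P x) × length L ≡ k

-- patterns (shifted down by 1)
p132 : Pattern
p132 = 3 Data.Product., (# 0 ∷ # 2 ∷ # 1 ∷ [])

p123 : Pattern
p123 = 3 Data.Product., (# 0 ∷ # 1 ∷ # 2 ∷ [])

γ222 : Pattern
γ222 = 7 Data.Product., (# 6 ∷ # 5 ∷ # 3 ∷ # 2 ∷ # 4 ∷ # 1 ∷ # 0 ∷ [])

R : List Pattern
R = p132 ∷ p123 ∷ γ222 ∷ []

FPS : Set
FPS = ℕ → ℤ

-- polynomial given by its coefficient list (constant term first)
poly : List ℤ → FPS
poly [] n = + 0
poly (c ∷ cs) zero = c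
poly (c ∷ cs) (suc n) = poly cs n

_⊕_ : FPS → FPS → FPS
(f ⊕ g) n = f n ℤ.+ g n

-- Σ_{i=0}^{n} f i * g (n - i)
conv : FPS → FPS → ℕ → FPS
conv f g zero m = f zero ℤ.* g m
conv f g (suc i) m = f (suc i) ℤ.* g m ℤ.+ conv f g i (suc m)

_⊛_ : FPS → FPS → FPS
(f ⊛ g) n = conv f g n 0

-- A permutation avoiding 123 and 132 starts with its largest or its second largest entry, so it
-- is obtained from the empty permutation by repeatedly prepending one of these two letters.
-- Removing the first letter turns the set of patterns to be avoided into another finite set of
-- patterns, some of whose positions may be required to carry the maximum.  Starting from
-- {123, 132, γ₂₂₂} only eleven such sets arise; this finite automaton is verified by computation
-- and enumerates S_n(123, 132, γ₂₂₂) without repetitions.  Reading off its transitions gives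
-- linear recurrences whose solutions are eventually of the form a F(n+1) + b F(n) + c n + d,
-- and (1 - x)²(1 - x - x²) annihilates every such sequence, which yields the generating function.
module Submission where

module Occurrences where
  open import Data.Nat using (ℕ; zero; suc; _<_; z≤n; s≤s; s≤s⁻¹)
  open import Data.Nat.Properties using (<-irrefl; <-trans)
  open import Data.Fin using (Fin; zero; suc) renaming (_<_ to _<ᶠ_)
  open import Data.Vec using (Vec; _∷_; lookup)
  open import Data.Bool using (Bool; true; false)
  open import Data.Product using (Σ; _×_; _,_; proj₁; proj₂)
  open import Data.Sum using (_⊎_; inj₁; inj₂)
  open import Data.Unit using (⊤; tt)
  open import Data.Empty using (⊥-elim)
  open import Function using (_∘′_)
  open import Function.Bundles using (_⇔_; mk⇔)
  open import Relation.Binary.PropositionalEquality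

  Seq : ℕ → Set
  Seq n = Fin n → ℕ

  _◂_ : ∀ {n} → ℕ → Seq n → Seq (suc n)
  (x ◂ T) zero = x
  (x ◂ T) (suc i) = T i

  Increasing : ∀ {k n} → (Fin k → Fin n) → Set
  Increasing f = ∀ i j → i <ᶠ j → f i <ᶠ f j

  -- A pattern of size k, given by values whose relative order is what matters.  When the flag
  -- is set, the marks prescribe which pattern positions land on the distinguished value K of
  -- the sequence (in the enumeration, K is always the largest entry).
  MarkedPattern : Set
  MarkedPattern = Σ ℕ λ k → Bool × Vec ℕ k × Vec Bool k

  IsOccurrence : ∀ {n k} → Seq n → Vec ℕ k → (Fin k → Fin n) → Set
  IsOccurrence P vs f = Increasing f × (∀ i j → (P (f i) < P (f j)) ⇔ (lookup vs i < lookup vs j))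

  MarksMatch : Bool → ∀ {n k} → Seq n → ℕ → Vec Bool k → (Fin k → Fin n) → Set
  MarksMatch false P K ms f = ⊤
  MarksMatch true P K ms f = ∀ i → (P (f i) ≡ K) ⇔ (lookup ms i ≡ true)

  Occurs : ∀ {n} → Seq n → ℕ → MarkedPattern → Set
  Occurs {n} P K (k , b , vs , ms) = Σ (Fin k → Fin n) λ f → IsOccurrence P vs f × MarksMatch b P K ms f

  isOccurrence-transport : ∀ {n n′ k} (P : Seq n) (P′ : Seq n′) (vs : Vec ℕ k) f f′ →
    (∀ i → P (f i) ≡ P′ (f′ i)) → (∀ i j → f i <ᶠ f j → f′ i <ᶠ f′ j) →
    IsOccurrence P vs f → IsOccurrence P′ vs f′
  isOccurrence-transport P P′ vs f f′ eq mono (f↑ , order) =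
    (λ i j i<j → mono i j (f↑ i j i<j)) ,
    λ i j → subst₂ (λ a b → (a < b) ⇔ _) (eq i) (eq j) (order i j)

  marksMatch-transport : ∀ b {n n′ k} (P : Seq n) (P′ : Seq n′) K (ms : Vec Bool k) f f′ →
    (∀ i → P (f i) ≡ P′ (f′ i)) → MarksMatch b P K ms f → MarksMatch b P′ K ms f′
  marksMatch-transport false P P′ K ms f f′ eq _ = tt
  marksMatch-transport true P P′ K ms f f′ eq marks i = subst (λ a → (a ≡ K) ⇔ _) (eq i) (marks i)

  occurs-cong : ∀ {n} {P P′ : Seq n} {K} e → (∀ i → P i ≡ P′ i) → Occurs P K e → Occurs P′ K e
  occurs-cong {P = P} {P′} {K} (k , b , vs , ms) eq (f , occ , marks) =
    f , isOccurrence-transport P P′ vs f f (λ i → eq (f i)) (λ _ _ lt → lt) occ ,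
    marksMatch-transport b P P′ K ms f f (λ i → eq (f i)) marks

  SameOrder : ℕ → ℕ → ℕ → ℕ → Set
  SameOrder x y s t = ((x < y) ⇔ (s < t)) × ((y < x) ⇔ (t < s))

  -- An occurrence of the pattern s ∷ ρ in x ◂ T that uses the head x, described inside T.
  OccursAtHead : ∀ {n} → ℕ → Seq n → ℕ → Bool → ℕ → Bool → ∀ {k} → Vec ℕ k → Vec Bool k → Set
  OccursAtHead {n} x T K b s m {k} ρ ms = Σ (Fin k → Fin n) λ g → IsOccurrence T ρ g ×
    (∀ i → SameOrder x (T (g i)) s (lookup ρ i)) ×
    MarksMatch b T K ms g × (b ≡ true → (x ≡ K) ⇔ (m ≡ true))

  occurs-tail : ∀ {n} x (T : Seq n) K e → Occurs T K e → Occurs (x ◂ T) K e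
  occurs-tail x T K (k , b , vs , ms) (g , occ , marks) =
    suc ∘′ g , isOccurrence-transport T (x ◂ T) vs g (suc ∘′ g) (λ _ → refl) (λ _ _ → s≤s) occ ,
    marksMatch-transport b T (x ◂ T) K ms g (suc ∘′ g) (λ _ → refl) marks

  occurs-head : ∀ {n} x (T : Seq n) K b s m {k} (ρ : Vec ℕ k) ms →
    OccursAtHead x T K b s m ρ ms → Occurs (x ◂ T) K (suc k , b , s ∷ ρ , m ∷ ms)
  occurs-head {n} x T K b s m {k} ρ ms (g , (g↑ , order) , sameOrder , marks , markHead) =
    f , (f↑ , orderf) , marksf b marks markHead
    where
    f : Fin (suc k) → Fin (suc n)
    f zero = zero
    f (suc i) = suc (g i)
    f↑ : Increasing f
    f↑ zero (suc j) _ = s≤s z≤n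
    f↑ (suc i) (suc j) (s≤s i<j) = s≤s (g↑ i j i<j)
    orderf : ∀ i j → ((x ◂ T) (f i) < (x ◂ T) (f j)) ⇔ (lookup (s ∷ ρ) i < lookup (s ∷ ρ) j)
    orderf zero zero = mk⇔ (⊥-elim ∘′ <-irrefl refl) (⊥-elim ∘′ <-irrefl refl)
    orderf zero (suc j) = proj₁ (sameOrder j)
    orderf (suc i) zero = proj₂ (sameOrder i)
    orderf (suc i) (suc j) = order i j
    marksf : ∀ b → MarksMatch b T K ms g → (b ≡ true → (x ≡ K) ⇔ (m ≡ true)) → MarksMatch b (x ◂ T) K (m ∷ ms) f
    marksf false _ _ = tt
    marksf true marks markHead zero = markHead refl
    marksf true marks markHead (suc i) = marks i

  private
    unsuc : ∀ {n} (j : Fin (suc n)) → zero {n} <ᶠ j → Σ (Fin n) λ j′ → j ≡ suc j′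
    unsuc (suc j) _ = j , refl

    dropHead : ∀ {k n} (f : Fin k → Fin (suc n)) → (∀ i → zero {n} <ᶠ f i) →
      Σ (Fin k → Fin n) λ g → ∀ i → f i ≡ suc (g i)
    dropHead f pos = (λ i → proj₁ (unsuc (f i) (pos i))) , (λ i → proj₂ (unsuc (f i) (pos i)))

    avoidsHead : ∀ {k n} {f : Fin (suc k) → Fin (suc n)} {j} → Increasing f → f zero ≡ suc j → ∀ i → zero {n} <ᶠ f i
    avoidsHead {n = n} f↑ f0 zero = subst (zero {n} <ᶠ_) (sym f0) (s≤s z≤n)
    avoidsHead f↑ f0 (suc i) = <-trans (avoidsHead f↑ f0 zero) (f↑ zero (suc i) (s≤s z≤n))

    isOccurrence-tail : ∀ {n k} {P : Seq n} {s} {ρ : Vec ℕ k} {f} →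
      IsOccurrence P (s ∷ ρ) f → IsOccurrence P ρ (f ∘′ suc)
    isOccurrence-tail (f↑ , order) = (λ i j i<j → f↑ (suc i) (suc j) (s≤s i<j)) , (λ i j → order (suc i) (suc j))

    marksMatch-tail : ∀ b {n k} {P : Seq n} {K m} {ms : Vec Bool k} {f} →
      MarksMatch b P K (m ∷ ms) f → MarksMatch b P K ms (f ∘′ suc)
    marksMatch-tail false _ = tt
    marksMatch-tail true marks = λ i → marks (suc i)

  occurs-split : ∀ {n} x (T : Seq n) K b s m {k} (ρ : Vec ℕ k) ms →
    Occurs (x ◂ T) K (suc k , b , s ∷ ρ , m ∷ ms) →
    Occurs T K (suc k , b , s ∷ ρ , m ∷ ms) ⊎ OccursAtHead x T K b s m ρ ms
  occurs-split x T K b s m ρ ms (f , occ@(f↑ , order) , marks) with f zero in f0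
  ... | zero with dropHead (f ∘′ suc) (λ i → subst (_<ᶠ f (suc i)) f0 (f↑ zero (suc i) (s≤s z≤n)))
  ...   | g , f≡ = inj₂ (g , occg , sameOrder , marksMatch-transport b _ T K ms _ g val (marksMatch-tail b marks) , markHead b marks)
    where
    val : ∀ i → (x ◂ T) (f (suc i)) ≡ T (g i)
    val i = cong (x ◂ T) (f≡ i)
    val0 : (x ◂ T) (f zero) ≡ x
    val0 = cong (x ◂ T) f0
    occg : IsOccurrence T ρ g
    occg = isOccurrence-transport (x ◂ T) T ρ (f ∘′ suc) g val
      (λ i j h → s≤s⁻¹ (subst₂ _<ᶠ_ (f≡ i) (f≡ j) h)) (isOccurrence-tail {P = x ◂ T} occ)
    sameOrder : ∀ i → SameOrder x (T (g i)) s (lookup ρ i)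
    sameOrder i = subst₂ (λ a b → (a < b) ⇔ _) val0 (val i) (order zero (suc i)) ,
                  subst₂ (λ a b → (a < b) ⇔ _) (val i) val0 (order (suc i) zero)
    markHead : ∀ b → MarksMatch b (x ◂ T) K (m ∷ ms) f → b ≡ true → (x ≡ K) ⇔ (m ≡ true)
    markHead true marks refl = subst (λ a → (a ≡ K) ⇔ _) val0 (marks zero)
  occurs-split x T K b s m ρ ms (f , occ@(f↑ , _) , marks) | suc _ with dropHead f (avoidsHead f↑ f0)
  ...   | g , f≡ = inj₁ (g , isOccurrence-transport (x ◂ T) T (s ∷ ρ) f g val
          (λ i j h → s≤s⁻¹ (subst₂ _<ᶠ_ (f≡ i) (f≡ j) h)) occ ,
        marksMatch-transport b (x ◂ T) T K (m ∷ ms) f g val marks)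
    where
    val : ∀ i → (x ◂ T) (f i) ≡ T (g i)
    val i = cong (x ◂ T) (f≡ i)

module Derivatives where
  open Occurrences
  open import Data.Nat using (ℕ; zero; suc; _<_; _<?_; _≟_)
  open import Data.Nat.Properties using (<-irrefl; <-trans; <-asym; <-cmp; n<1+n)
  open import Data.Fin using (Fin)
  open import Data.Fin.Properties using (all?)
  open import Data.Vec using (Vec; []; _∷_; lookup; replicate; map)
  open import Data.Vec.Properties using (lookup-map; ≡-dec)
  open import Data.Vec.Relation.Binary.Pointwise.Extensional using (ext; Pointwise-≡⇒≡)
  open import Data.Bool using (Bool; true; false) renaming (_≟_ to _≟ᵇ_)
  open import Data.Bool.Properties using (¬-not)
  open import Data.List using (List; []; _∷_; _++_; concatMap)
  open import Data.List.Membership.Propositional using (_∈_)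
  open import Data.List.Membership.Propositional.Properties using (∈-++⁺ˡ; ∈-++⁺ʳ; ∈-++⁻)
  open import Data.List.Relation.Unary.Any using (here; there)
  open import Data.List.Relation.Unary.All as All using (All; []; _∷_)
  open import Data.List.Relation.Unary.All.Properties using (++⁺; ++⁻)
  open import Data.Product using (Σ; _×_; _,_; proj₁; proj₂)
  open import Data.Sum using (_⊎_; inj₁; inj₂)
  open import Data.Unit using (tt)
  open import Data.Empty using (⊥-elim)
  open import Function using (_∘′_; case_of_)
  open import Function.Bundles using (_⇔_; mk⇔; Equivalence)
  import Function.Properties.Equivalence as ⇔
  open import Relation.Binary.PropositionalEquality
  open import Relation.Binary.Definitions using (tri<; tri≈; tri>)
  open import Relation.Nullary using (¬_; Dec; yes; no; does)
  open import Relation.Nullary.Decidable using (_×-dec_; ¬?)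

  open Equivalence using (to; from)

  plain : ∀ {k} → Vec ℕ k → MarkedPattern
  plain {k} vs = k , false , vs , replicate k false

  marked : ∀ {k} → Vec ℕ k → Vec Bool k → MarkedPattern
  marked {k} vs ms = k , true , vs , ms

  marksAbove : ∀ {k} → ℕ → Vec ℕ k → Vec Bool k
  marksAbove s = map (λ v → does (s <? v))

  [_]-if_ : ∀ {A : Set} → MarkedPattern → Dec A → List MarkedPattern
  [ e ]-if yes _ = e ∷ []
  [ e ]-if no _ = []

  AllBelow : ∀ {k} → ℕ → Vec ℕ k → Set
  AllBelow s ρ = ∀ i → lookup ρ i < s

  Omits : ∀ {k} → ℕ → Vec ℕ k → Set
  Omits s ρ = ∀ i → lookup ρ i ≢ s

  Unmarked : ∀ {k} → Vec Bool k → Set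
  Unmarked ms = ∀ i → lookup ms i ≡ false

  allBelow? : ∀ {k} s (ρ : Vec ℕ k) → Dec (AllBelow s ρ)
  allBelow? s ρ = all? (λ i → lookup ρ i <? s)

  omits? : ∀ {k} s (ρ : Vec ℕ k) → Dec (Omits s ρ)
  omits? s ρ = all? (λ i → ¬? (lookup ρ i ≟ s))

  unmarked? : ∀ {k} (ms : Vec Bool k) → Dec (Unmarked ms)
  unmarked? ms = all? (λ i → lookup ms i ≟ᵇ false)

  -- Patterns to avoid after removing a first entry equal to the maximum.
  ∂max : MarkedPattern → List MarkedPattern
  ∂max (zero , _ , [] , []) = plain [] ∷ []
  ∂max (suc k , false , s ∷ ρ , m ∷ ms) = plain (s ∷ ρ) ∷ [ plain ρ ]-if allBelow? s ρ
  ∂max (suc k , true , s ∷ ρ , m ∷ ms) =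
    [ plain (s ∷ ρ) ]-if unmarked? (m ∷ ms) ++
    [ plain ρ ]-if ((m ≟ᵇ true) ×-dec (unmarked? ms ×-dec allBelow? s ρ))

  -- Patterns to avoid after removing a first entry equal to the second largest value.
  ∂next : MarkedPattern → List MarkedPattern
  ∂next (zero , _ , [] , []) = plain [] ∷ []
  ∂next (suc k , false , s ∷ ρ , m ∷ ms) = plain (s ∷ ρ) ∷ [ marked ρ (marksAbove s ρ) ]-if omits? s ρ
  ∂next (suc k , true , s ∷ ρ , m ∷ ms) =
    marked (s ∷ ρ) (m ∷ ms) ∷
    [ marked ρ ms ]-if ((m ≟ᵇ false) ×-dec (omits? s ρ ×-dec ≡-dec _≟ᵇ_ ms (marksAbove s ρ)))

  ∈-if⁺ : ∀ {A : Set} (d : Dec A) {e} → A → e ∈ [ e ]-if d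
  ∈-if⁺ (yes _) _ = here refl
  ∈-if⁺ (no ¬a) a = ⊥-elim (¬a a)

  ∈-if⁻ : ∀ {A : Set} (d : Dec A) {e e′} → e′ ∈ [ e ]-if d → A × e′ ≡ e
  ∈-if⁻ (yes a) (here eq) = a , eq

  does≡true⇔ : ∀ {A : Set} (d : Dec A) → (does d ≡ true) ⇔ A
  does≡true⇔ (yes a) = mk⇔ (λ _ → a) (λ _ → refl)
  does≡true⇔ (no ¬a) = mk⇔ (λ ()) (⊥-elim ∘′ ¬a)

  marksAbove-true⇔ : ∀ {k} s (ρ : Vec ℕ k) i → (lookup (marksAbove s ρ) i ≡ true) ⇔ (s < lookup ρ i)
  marksAbove-true⇔ s ρ i =
    subst (λ b → (b ≡ true) ⇔ (s < lookup ρ i)) (sym (lookup-map i _ ρ)) (does≡true⇔ (s <? lookup ρ i))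

  ≡true⇔⇒≡ : ∀ {a b : Bool} → ((a ≡ true) ⇔ (b ≡ true)) → a ≡ b
  ≡true⇔⇒≡ {true} {true} _ = refl
  ≡true⇔⇒≡ {false} {false} _ = refl
  ≡true⇔⇒≡ {true} {false} h = sym (to h refl)
  ≡true⇔⇒≡ {false} {true} h = from h refl

  ⇔-bothFalse : ∀ {A B : Set} → ¬ A → ¬ B → A ⇔ B
  ⇔-bothFalse ¬a ¬b = mk⇔ (⊥-elim ∘′ ¬a) (⊥-elim ∘′ ¬b)

  ⇔-bothTrue : ∀ {A B : Set} → A → B → A ⇔ B
  ⇔-bothTrue a b = mk⇔ (λ _ → b) (λ _ → a)

  occurs-empty : ∀ {n} (P : Seq n) K b → Occurs P K (zero , b , [] , [])
  occurs-empty P K false = (λ ()) , ((λ ()) , (λ ())) , tt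
  occurs-empty P K true = (λ ()) , ((λ ()) , (λ ())) , (λ ())

  values : (e : MarkedPattern) → Vec ℕ (proj₁ e)
  values (_ , _ , vs , _) = vs

  occurs-plain : ∀ {n} (P : Seq n) K K′ e → Occurs P K e → Occurs P K′ (plain (values e))
  occurs-plain P K K′ e (f , occ , _) = f , occ , tt

  isOccurrence-relabel : ∀ {n k} (P Q : Seq n) (vs : Vec ℕ k) g → (∀ i j → (P i < P j) ⇔ (Q i < Q j)) →
    IsOccurrence P vs g → IsOccurrence Q vs g
  isOccurrence-relabel P Q vs g order (g↑ , orderP) = g↑ , λ i j → ⇔.trans (⇔.sym (order (g i) (g j))) (orderP i j)

  occurs-relabel : ∀ {n} (P Q : Seq n) K K′ →
    (∀ i j → (P i < P j) ⇔ (Q i < Q j)) → (∀ i → (P i ≡ K) ⇔ (Q i ≡ K′)) → ∀ e → Occurs P K e → Occurs Q K′ e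
  occurs-relabel P Q K K′ order top (k , b , vs , ms) (f , occ , marks) =
    f , isOccurrence-relabel P Q vs f order occ , marks′ b marks
    where
    marks′ : ∀ b → MarksMatch b P K ms f → MarksMatch b Q K′ ms f
    marks′ false _ = tt
    marks′ true marks i = ⇔.trans (⇔.sym (top (f i))) (marks i)

  IsDerivative : (MarkedPattern → List MarkedPattern) → ∀ {a b} → Seq a → ℕ → Seq b → ℕ → Set
  IsDerivative ∂ P K Q K′ =
    (∀ e → Occurs P K e → Σ MarkedPattern λ e′ → e′ ∈ ∂ e × Occurs Q K′ e′) ×
    (∀ e e′ → e′ ∈ ∂ e → Occurs Q K′ e′ → Occurs P K e)

  AvoidsAll : ∀ {n} → Seq n → ℕ → List MarkedPattern → Set
  AvoidsAll P K = All (λ e → ¬ Occurs P K e)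

  avoidsAll-derivative : ∀ {∂ a b} {P : Seq a} {K} {Q : Seq b} {K′} → IsDerivative ∂ P K Q K′ →
    ∀ E → AvoidsAll P K E ⇔ AvoidsAll Q K′ (concatMap ∂ E)
  avoidsAll-derivative (fwd , bwd) [] = mk⇔ (λ _ → []) (λ _ → [])
  avoidsAll-derivative {∂} {P = P} {K} {Q} {K′} (fwd , bwd) (e ∷ E) = mk⇔
    (λ { (¬occ ∷ av) → ++⁺ (All.tabulate (λ {e′} mem occ → ¬occ (bwd e e′ mem occ))) (to ih av) })
    (λ av → let (av₁ , av₂) = ++⁻ (∂ e) av in
       (λ occ → let (e′ , mem , occ′) = fwd e occ in All.lookup av₁ mem occ′) ∷ from ih av₂)
    where
    ih : AvoidsAll P K E ⇔ AvoidsAll Q K′ (concatMap ∂ E)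
    ih = avoidsAll-derivative (fwd , bwd) E

  isDerivative-cong : ∀ {∂ a b} {P P′ : Seq a} {K} {Q : Seq b} {K′} → (∀ i → P i ≡ P′ i) →
    IsDerivative ∂ P′ K Q K′ → IsDerivative ∂ P K Q K′
  isDerivative-cong P≗P′ (fwd , bwd) =
    (λ e occ → fwd e (occurs-cong e P≗P′ occ)) ,
    (λ e e′ mem occ → occurs-cong e (λ i → sym (P≗P′ i)) (bwd e e′ mem occ))

  module MaxFirst {n} (Q : Seq n) (Q<n : ∀ i → Q i < n) (K′ : ℕ) where

    private
      Q≢n : ∀ i → Q i ≢ n
      Q≢n i eq = <-irrefl eq (Q<n i)

      marksMatch⇔unmarked : ∀ {k} (ms : Vec Bool k) (g : Fin k → Fin n) → MarksMatch true Q n ms g ⇔ Unmarked ms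
      marksMatch⇔unmarked ms g = mk⇔
        (λ marks i → ¬-not (Q≢n (g i) ∘′ from (marks i)))
        (λ none i → ⇔-bothFalse (Q≢n (g i)) (λ t → case trans (sym (none i)) t of λ ()))

      allBelow : ∀ {k} s (ρ : Vec ℕ k) (g : Fin k → Fin n) → (∀ i → SameOrder n (Q (g i)) s (lookup ρ i)) → AllBelow s ρ
      allBelow s ρ g order i = to (proj₂ (order i)) (Q<n (g i))

      headOrder : ∀ {k} s (ρ : Vec ℕ k) (g : Fin k → Fin n) → AllBelow s ρ → ∀ i → SameOrder n (Q (g i)) s (lookup ρ i)
      headOrder s ρ g below i = ⇔-bothFalse (<-asym (Q<n (g i))) (<-asym (below i)) , ⇔-bothTrue (Q<n (g i)) (below i)

    occurs⇒∂max : ∀ e → Occurs (n ◂ Q) n e → Σ MarkedPattern λ e′ → e′ ∈ ∂max e × Occurs Q K′ e′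
    occurs⇒∂max (zero , _ , [] , []) _ = plain [] , here refl , occurs-empty Q K′ false
    occurs⇒∂max (suc k , false , s ∷ ρ , m ∷ ms) occ with occurs-split n Q n false s m ρ ms occ
    ... | inj₁ occ′ = plain (s ∷ ρ) , here refl , occurs-plain Q n K′ (suc k , false , s ∷ ρ , m ∷ ms) occ′
    ... | inj₂ (g , occg , order , _) = plain ρ , there (∈-if⁺ (allBelow? s ρ) (allBelow s ρ g order)) , g , occg , tt
    occurs⇒∂max (suc k , true , s ∷ ρ , m ∷ ms) occ with occurs-split n Q n true s m ρ ms occ
    ... | inj₁ occ′@(f , _ , marks) =
      plain (s ∷ ρ) , ∈-++⁺ˡ (∈-if⁺ (unmarked? (m ∷ ms)) (to (marksMatch⇔unmarked (m ∷ ms) f) marks)) ,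
      occurs-plain Q n K′ (suc k , true , s ∷ ρ , m ∷ ms) occ′
    ... | inj₂ (g , occg , order , marks , markHead) =
      plain ρ ,
      ∈-++⁺ʳ _ (∈-if⁺ ((m ≟ᵇ true) ×-dec (unmarked? ms ×-dec allBelow? s ρ))
        (to (markHead refl) refl , to (marksMatch⇔unmarked ms g) marks , allBelow s ρ g order)) ,
      g , occg , tt

    ∂max⇒occurs : ∀ e e′ → e′ ∈ ∂max e → Occurs Q K′ e′ → Occurs (n ◂ Q) n e
    ∂max⇒occurs (zero , b , [] , []) _ _ _ = occurs-empty (n ◂ Q) n b
    ∂max⇒occurs e@(suc k , false , s ∷ ρ , m ∷ ms) _ (here refl) (f , occ , _) = occurs-tail n Q n e (f , occ , tt)
    ∂max⇒occurs (suc k , false , s ∷ ρ , m ∷ ms) _ (there mem) (g , occ , _) with ∈-if⁻ (allBelow? s ρ) mem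
    ... | below , refl = occurs-head n Q n false s m ρ ms (g , occ , headOrder s ρ g below , tt , λ ())
    ∂max⇒occurs e@(suc k , true , s ∷ ρ , m ∷ ms) _ mem (g , occ , _) with ∈-++⁻ ([ plain (s ∷ ρ) ]-if unmarked? (m ∷ ms)) mem
    ... | inj₁ mem₁ with ∈-if⁻ (unmarked? (m ∷ ms)) mem₁
    ...   | none , refl = occurs-tail n Q n e (g , occ , from (marksMatch⇔unmarked (m ∷ ms) g) none)
    ∂max⇒occurs (suc k , true , s ∷ ρ , m ∷ ms) _ mem (g , occ , _) | inj₂ mem₂
      with ∈-if⁻ ((m ≟ᵇ true) ×-dec (unmarked? ms ×-dec allBelow? s ρ)) mem₂
    ... | (m≡true , none , below) , refl =
      occurs-head n Q n true s m ρ ms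
        (g , occ , headOrder s ρ g below , from (marksMatch⇔unmarked ms g) none , λ _ → ⇔-bothTrue refl m≡true)

    isDerivative : IsDerivative ∂max (n ◂ Q) n Q K′
    isDerivative = occurs⇒∂max , ∂max⇒occurs

  sameOrder-fromAbove : ∀ {x y s t} → y ≢ x → t ≢ s → ((x < y) ⇔ (s < t)) → SameOrder x y s t
  sameOrder-fromAbove {x} {y} {s} {t} y≢x t≢s above = above , mk⇔ below⇒ below⇐
    where
    below⇒ : y < x → t < s
    below⇒ y<x with <-cmp t s
    ... | tri< t<s _ _ = t<s
    ... | tri≈ _ t≡s _ = ⊥-elim (t≢s t≡s)
    ... | tri> _ _ s<t = ⊥-elim (<-asym y<x (from above s<t))
    below⇐ : t < s → y < x
    below⇐ t<s with <-cmp y x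
    ... | tri< y<x _ _ = y<x
    ... | tri≈ _ y≡x _ = ⊥-elim (y≢x y≡x)
    ... | tri> _ _ x<y = ⊥-elim (<-asym t<s (to above x<y))

  -- T is Q with its largest value c raised to c + 1, making room for a new entry c.
  module NextFirst {c} (Q T : Seq (suc c))
    (raise : ∀ i → (Q i < c × T i ≡ Q i) ⊎ (Q i ≡ c × T i ≡ suc c)) where

    private
      order : ∀ i j → (T i < T j) ⇔ (Q i < Q j)
      order i j with raise i | raise j
      ... | inj₁ (qi<c , ti) | inj₁ (qj<c , tj) rewrite ti | tj = ⇔.refl
      ... | inj₁ (qi<c , ti) | inj₂ (qj , tj) rewrite ti | tj | qj = ⇔-bothTrue (<-trans qi<c (n<1+n c)) qi<c
      ... | inj₂ (qi , ti) | inj₁ (qj<c , tj) rewrite ti | tj | qi =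
        ⇔-bothFalse (<-asym (<-trans qj<c (n<1+n c))) (<-asym qj<c)
      ... | inj₂ (qi , ti) | inj₂ (qj , tj) rewrite ti | tj | qi | qj = ⇔-bothFalse (<-irrefl refl) (<-irrefl refl)

      top : ∀ i → (T i ≡ suc c) ⇔ (Q i ≡ c)
      top i with raise i
      ... | inj₁ (qi<c , ti) rewrite ti = ⇔-bothFalse (λ eq → <-irrefl eq (<-trans qi<c (n<1+n c))) (λ eq → <-irrefl eq qi<c)
      ... | inj₂ (qi , ti) rewrite ti = ⇔-bothTrue refl qi

      T≢c : ∀ i → T i ≢ c
      T≢c i with raise i
      ... | inj₁ (qi<c , ti) rewrite ti = λ eq → <-irrefl eq qi<c
      ... | inj₂ (qi , ti) rewrite ti = λ eq → <-irrefl (sym eq) (n<1+n c)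

      c<T⇔ : ∀ i → (c < T i) ⇔ (Q i ≡ c)
      c<T⇔ i with raise i
      ... | inj₁ (qi<c , ti) rewrite ti = ⇔-bothFalse (<-asym qi<c) (λ eq → <-irrefl eq qi<c)
      ... | inj₂ (qi , ti) rewrite ti = ⇔-bothTrue (n<1+n c) qi

      occurs-T⇒Q : ∀ e → Occurs T (suc c) e → Occurs Q c e
      occurs-T⇒Q = occurs-relabel T Q (suc c) c order top

      occurs-Q⇒T : ∀ e → Occurs Q c e → Occurs T (suc c) e
      occurs-Q⇒T = occurs-relabel Q T c (suc c) (λ i j → ⇔.sym (order i j)) (λ i → ⇔.sym (top i))

      module _ {k} (s : ℕ) (ρ : Vec ℕ k) (g : Fin k → Fin (suc c)) where

        omits : (∀ i → SameOrder c (T (g i)) s (lookup ρ i)) → Omits s ρ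
        omits same i eq with <-cmp (T (g i)) c
        ... | tri< t<c _ _ = <-irrefl eq (to (proj₂ (same i)) t<c)
        ... | tri≈ _ t≡c _ = T≢c (g i) t≡c
        ... | tri> _ _ c<t = <-irrefl (sym eq) (to (proj₁ (same i)) c<t)

        marks⇔above : (∀ i → SameOrder c (T (g i)) s (lookup ρ i)) →
          ∀ i → (Q (g i) ≡ c) ⇔ (lookup (marksAbove s ρ) i ≡ true)
        marks⇔above same i = ⇔.trans (⇔.sym (c<T⇔ (g i))) (⇔.trans (proj₁ (same i)) (⇔.sym (marksAbove-true⇔ s ρ i)))

        sameOrder-fromMarks : Omits s ρ → (∀ i → (Q (g i) ≡ c) ⇔ (lookup (marksAbove s ρ) i ≡ true)) →
          ∀ i → SameOrder c (T (g i)) s (lookup ρ i)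
        sameOrder-fromMarks s∉ρ marks i = sameOrder-fromAbove (T≢c (g i)) (s∉ρ i)
          (⇔.trans (c<T⇔ (g i)) (⇔.trans (marks i) (marksAbove-true⇔ s ρ i)))

    occurs⇒∂next : ∀ e → Occurs (c ◂ T) (suc c) e → Σ MarkedPattern λ e′ → e′ ∈ ∂next e × Occurs Q c e′
    occurs⇒∂next (zero , _ , [] , []) _ = plain [] , here refl , occurs-empty Q c false
    occurs⇒∂next e@(suc k , false , s ∷ ρ , m ∷ ms) occ with occurs-split c T (suc c) false s m ρ ms occ
    ... | inj₁ occ′ = plain (s ∷ ρ) , here refl , occurs-plain Q c c e (occurs-T⇒Q e occ′)
    ... | inj₂ (g , occg , same , _) =
      marked ρ (marksAbove s ρ) , there (∈-if⁺ (omits? s ρ) (omits s ρ g same)) ,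
      g , isOccurrence-relabel T Q ρ g order occg , marks⇔above s ρ g same
    occurs⇒∂next e@(suc k , true , s ∷ ρ , m ∷ ms) occ with occurs-split c T (suc c) true s m ρ ms occ
    ... | inj₁ occ′ = e , here refl , occurs-T⇒Q e occ′
    ... | inj₂ (g , occg , same , marks , markHead) =
      marked ρ ms ,
      there (∈-if⁺ ((m ≟ᵇ false) ×-dec (omits? s ρ ×-dec ≡-dec _≟ᵇ_ ms (marksAbove s ρ)))
        (¬-not (λ m≡true → <-irrefl (from (markHead refl) m≡true) (n<1+n c)) , omits s ρ g same , ms≡above)) ,
      g , isOccurrence-relabel T Q ρ g order occg , (λ i → ⇔.trans (⇔.sym (top (g i))) (marks i))
      where
      ms≡above : ms ≡ marksAbove s ρ
      ms≡above = Pointwise-≡⇒≡ (ext λ i → ≡true⇔⇒≡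
        (⇔.trans (⇔.sym (marks i)) (⇔.trans (top (g i)) (marks⇔above s ρ g same i))))

    ∂next⇒occurs : ∀ e e′ → e′ ∈ ∂next e → Occurs Q c e′ → Occurs (c ◂ T) (suc c) e
    ∂next⇒occurs (zero , b , [] , []) _ _ _ = occurs-empty (c ◂ T) (suc c) b
    ∂next⇒occurs e@(suc k , false , s ∷ ρ , m ∷ ms) _ (here refl) (f , occ , _) =
      occurs-tail c T (suc c) e (occurs-Q⇒T e (f , occ , tt))
    ∂next⇒occurs (suc k , false , s ∷ ρ , m ∷ ms) _ (there mem) (g , occ , marks) with ∈-if⁻ (omits? s ρ) mem
    ... | s∉ρ , refl =
      occurs-head c T (suc c) false s m ρ ms
        (g , isOccurrence-relabel Q T ρ g (λ i j → ⇔.sym (order i j)) occ , sameOrder-fromMarks s ρ g s∉ρ marks , tt , λ ())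
    ∂next⇒occurs e@(suc k , true , s ∷ ρ , m ∷ ms) _ (here refl) occ = occurs-tail c T (suc c) e (occurs-Q⇒T e occ)
    ∂next⇒occurs (suc k , true , s ∷ ρ , m ∷ ms) _ (there mem) (g , occ , marks)
      with ∈-if⁻ ((m ≟ᵇ false) ×-dec (omits? s ρ ×-dec ≡-dec _≟ᵇ_ ms (marksAbove s ρ))) mem
    ... | (m≡false , s∉ρ , refl) , refl =
      occurs-head c T (suc c) true s m ρ ms
        (g , isOccurrence-relabel Q T ρ g (λ i j → ⇔.sym (order i j)) occ , sameOrder-fromMarks s ρ g s∉ρ marks ,
         (λ i → ⇔.trans (top (g i)) (marks i)) ,
         λ _ → ⇔-bothFalse (λ c≡1+c → <-irrefl c≡1+c (n<1+n c)) (λ m≡true → case trans (sym m≡false) m≡true of λ ()))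

    isDerivative : IsDerivative ∂next (c ◂ T) (suc c) Q c
    isDerivative = occurs⇒∂next , ∂next⇒occurs

module Automaton where
  open Occurrences
  open Derivatives
  open import Data.Nat as ℕ using (ℕ; zero)
  open import Data.Nat.Properties using (<-irrefl)
  open import Data.Fin as Fin using (Fin; toℕ)
  open import Data.Fin.Properties using (any?; <-cmp)
  open import Data.Vec as Vec using (Vec; []; _∷_; lookup; replicate)
  open import Data.Vec.Properties using () renaming (≡-dec to ≡-decᵛ)
  open import Data.Bool as Bool using (Bool; true; false)
  open import Data.Maybe using (Maybe; just; nothing)
  open import Data.List using (List; []; _∷_; concatMap)
  open import Data.List.Membership.Propositional using (_∈_)
  open import Data.List.Relation.Unary.Any as Any using (Any; here; there)
  open import Data.List.Relation.Unary.All as All using (All; []; _∷_)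
  open import Data.Product using (Σ; _×_; _,_; proj₁)
  import Data.Product.Properties as Product
  open import Data.Sum using (_⊎_; [_,_])
  open import Data.Empty using (⊥; ⊥-elim)
  open import Function.Bundles using (Equivalence)
  open import Function.Definitions using (Injective)
  open import Relation.Binary.PropositionalEquality using (_≡_; _≢_; refl; sym; trans; cong)
  open import Relation.Binary.Definitions using (DecidableEquality; tri<; tri≈; tri>)
  open import Relation.Nullary using (¬_; Dec; no)
  open import Relation.Nullary.Decidable using (_×-dec_; _⊎-dec_; ¬?; from-yes)

  _≟ᵖ_ : DecidableEquality MarkedPattern
  _≟ᵖ_ = Product.≡-dec ℕ._≟_ (Product.≡-dec Bool._≟_ (Product.≡-dec (≡-decᵛ ℕ._≟_) (≡-decᵛ Bool._≟_)))

  open import Data.List.Membership.DecPropositional _≟ᵖ_ using (_∈?_)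

  TwoMarked : ∀ {k} → Vec Bool k → Set
  TwoMarked {k} ms = Σ (Fin k) λ i → Σ (Fin k) λ j → i ≢ j × lookup ms i ≡ true × lookup ms j ≡ true

  Degenerate : MarkedPattern → Set
  Degenerate (_ , false , _ , _) = ⊥
  Degenerate (_ , true , _ , ms) = TwoMarked ms

  degenerate? : ∀ e → Dec (Degenerate e)
  degenerate? (_ , false , _ , _) = no λ ()
  degenerate? (_ , true , _ , ms) =
    any? λ i → any? λ j → ¬? (i Fin.≟ j) ×-dec (lookup ms i Bool.≟ true ×-dec lookup ms j Bool.≟ true)

  Covers : List MarkedPattern → List MarkedPattern → Set
  Covers E₁ E₂ = All (λ e → e ∈ E₂ ⊎ Degenerate e) E₁

  covers? : ∀ E₁ E₂ → Dec (Covers E₁ E₂)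
  covers? E₁ E₂ = All.all? (λ e → (e ∈? E₂) ⊎-dec degenerate? e) E₁

  IsEmpty : MarkedPattern → Set
  IsEmpty e = proj₁ e ≡ 0

  increasing-injective : ∀ {k n} {f : Fin k → Fin n} → Increasing f → ∀ {i j} → f i ≡ f j → i ≡ j
  increasing-injective {f = f} f↑ {i} {j} eq with <-cmp i j
  ... | tri< i<j _ _ = ⊥-elim (<-irrefl (cong toℕ eq) (f↑ i j i<j))
  ... | tri≈ _ i≡j _ = i≡j
  ... | tri> _ _ j<i = ⊥-elim (<-irrefl (cong toℕ (sym eq)) (f↑ j i j<i))

  ¬occurs-degenerate : ∀ {n} {P : Seq n} {K} → Injective _≡_ _≡_ P → ∀ e → Degenerate e → ¬ Occurs P K e
  ¬occurs-degenerate inj (_ , true , _ , _) (i , j , i≢j , mi , mj) (f , (f↑ , _) , marks) =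
    i≢j (increasing-injective f↑ (inj (trans (from (marks i) mi) (sym (from (marks j) mj)))))
    where open Equivalence

  avoidsAll-covered : ∀ {n} {P : Seq n} {K} → Injective _≡_ _≡_ P →
    ∀ {E₁ E₂} → Covers E₁ E₂ → AvoidsAll P K E₂ → AvoidsAll P K E₁
  avoidsAll-covered inj covers av = All.map [ All.lookup av , ¬occurs-degenerate inj _ ] covers

  ¬avoidsAll-empty : ∀ {n} {P : Seq n} {K} {E} → Any IsEmpty E → ¬ AvoidsAll P K E
  ¬avoidsAll-empty {P = P} {K} (here {x = zero , b , [] , []} refl) (¬occ ∷ _) = ¬occ (occurs-empty P K b)
  ¬avoidsAll-empty (there empty) (_ ∷ av) = ¬avoidsAll-empty empty av

  p123 p132 : Vec ℕ 3
  p123 = 0 ∷ 1 ∷ 2 ∷ []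
  p132 = 0 ∷ 2 ∷ 1 ∷ []

  γ₇ : Vec ℕ 7
  γ₇ = 6 ∷ 5 ∷ 3 ∷ 2 ∷ 4 ∷ 1 ∷ 0 ∷ []

  γ₆ : Vec ℕ 6
  γ₆ = Vec.tail γ₇

  γ₅ : Vec ℕ 5
  γ₅ = Vec.tail γ₆

  γ₄ : Vec ℕ 4
  γ₄ = Vec.tail γ₅

  γ₃ : Vec ℕ 3
  γ₃ = Vec.tail γ₄

  γ₂ : Vec ℕ 2
  γ₂ = Vec.tail γ₃

  γ₁ : Vec ℕ 1
  γ₁ = Vec.tail γ₂

  offMax : ∀ {k} → Vec ℕ k → MarkedPattern
  offMax vs = marked vs (replicate _ false)

  -- The states are the sets of marked patterns that the rest of a permutation has to avoid.
  -- Besides 123 and 132 they consist of suffixes γₖ of γ₂₂₂; in γ₄ and γ₃ the entry 4 is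
  -- required to be the maximum.
  data State : Set where
    q0 q1 q2 q3 q4 q5 q6 q7 q8 q9 q10 : State

  states : List State
  states = q0 ∷ q1 ∷ q2 ∷ q3 ∷ q4 ∷ q5 ∷ q6 ∷ q7 ∷ q8 ∷ q9 ∷ q10 ∷ []

  ∈-states : ∀ s → s ∈ states
  ∈-states q0 = here refl
  ∈-states q1 = there (here refl)
  ∈-states q2 = there (there (here refl))
  ∈-states q3 = there (there (there (here refl)))
  ∈-states q4 = there (there (there (there (here refl))))
  ∈-states q5 = there (there (there (there (there (here refl)))))
  ∈-states q6 = there (there (there (there (there (there (here refl))))))
  ∈-states q7 = there (there (there (there (there (there (there (here refl)))))))
  ∈-states q8 = there (there (there (there (there (there (there (there (here refl))))))))
  ∈-states q9 = there (there (there (there (there (there (there (there (there (here refl)))))))))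
  ∈-states q10 = there (there (there (there (there (there (there (there (there (there (here refl))))))))))

  γ-part : State → List MarkedPattern
  γ-part q0 = plain γ₇ ∷ []
  γ-part q1 = plain γ₆ ∷ plain γ₇ ∷ []
  γ-part q2 = offMax γ₆ ∷ plain γ₇ ∷ []
  γ-part q3 = plain γ₅ ∷ plain γ₆ ∷ plain γ₇ ∷ []
  γ-part q4 = offMax γ₅ ∷ offMax γ₆ ∷ plain γ₆ ∷ plain γ₇ ∷ []
  γ-part q5 = offMax γ₅ ∷ offMax γ₆ ∷ plain γ₇ ∷ []
  γ-part q6 = marked γ₄ (marksAbove 3 γ₄) ∷ offMax γ₅ ∷ plain γ₅ ∷ offMax γ₆ ∷ plain γ₆ ∷ plain γ₇ ∷ []
  γ-part q7 = marked γ₄ (marksAbove 3 γ₄) ∷ offMax γ₅ ∷ plain γ₅ ∷ marked γ₃ (marksAbove 3 γ₃) ∷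
              offMax γ₆ ∷ plain γ₆ ∷ plain γ₇ ∷ []
  γ-part q8 = plain γ₂ ∷ plain γ₅ ∷ plain γ₆ ∷ plain γ₇ ∷ []
  γ-part q9 = plain γ₁ ∷ plain γ₂ ∷ plain γ₅ ∷ plain γ₆ ∷ plain γ₇ ∷ []
  γ-part q10 = offMax γ₁ ∷ plain γ₂ ∷ marked γ₄ (marksAbove 3 γ₄) ∷ offMax γ₅ ∷ plain γ₅ ∷
               offMax γ₆ ∷ plain γ₆ ∷ plain γ₇ ∷ []

  patterns : State → List MarkedPattern
  patterns s = plain p123 ∷ plain p132 ∷ γ-part s

  afterMax : State → Maybe State
  afterMax q0 = just q1
  afterMax q1 = just q3
  afterMax q2 = just q1
  afterMax q3 = just q3
  afterMax q4 = just q3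
  afterMax q5 = just q3
  afterMax q6 = just q3
  afterMax q7 = just q8
  afterMax q8 = just q9
  afterMax q9 = nothing
  afterMax q10 = just q9

  afterNext : State → Maybe State
  afterNext q0 = just q2
  afterNext q1 = just q4
  afterNext q2 = just q5
  afterNext q3 = just q6
  afterNext q4 = just q4
  afterNext q5 = just q5
  afterNext q6 = just q7
  afterNext q7 = just q7
  afterNext q8 = just q10
  afterNext q9 = nothing
  afterNext q10 = nothing

  -- A transition to s′ means that ∂ maps the patterns of s onto those of s′ up to degenerate
  -- ones; no transition means that ∂ produces the empty pattern, which cannot be avoided.
  Transition : (MarkedPattern → List MarkedPattern) → State → Maybe State → Set
  Transition ∂ s (just s′) = Covers (patterns s′) (concatMap ∂ (patterns s)) × Covers (concatMap ∂ (patterns s)) (patterns s′)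
  Transition ∂ s nothing = Any IsEmpty (concatMap ∂ (patterns s))

  transition? : ∀ ∂ s t → Dec (Transition ∂ s t)
  transition? ∂ s (just s′) =
    covers? (patterns s′) (concatMap ∂ (patterns s)) ×-dec covers? (concatMap ∂ (patterns s)) (patterns s′)
  transition? ∂ s nothing = Any.any? (λ e → proj₁ e ℕ.≟ 0) (concatMap ∂ (patterns s))

  transition-afterMax : ∀ s → Transition ∂max s (afterMax s)
  transition-afterMax s = All.lookup (from-yes (All.all? (λ s → transition? ∂max s (afterMax s)) states)) (∈-states s)

  transition-afterNext : ∀ s → Transition ∂next s (afterNext s)
  transition-afterNext s = All.lookup (from-yes (All.all? (λ s → transition? ∂next s (afterNext s)) states)) (∈-states s)

  nonempty : ∀ s → All (λ e → ¬ IsEmpty e) (patterns s)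
  nonempty s = All.lookup (from-yes (All.all? (λ s → All.all? (λ e → ¬? (proj₁ e ℕ.≟ 0)) (patterns s)) states)) (∈-states s)

module Enumeration where
  open import Defs using (Perm; IsPerm)
  open Occurrences
  open Derivatives
  open Automaton
  open import Data.Nat using (ℕ; zero; suc; _<_; _≤_; z≤n; s≤s; pred; _+_)
  open import Data.Nat.Properties as ℕ using (<-irrefl; ≤-refl; _≤?_; ≰⇒>; +-cancelˡ-<; +-monoʳ-<)
  open import Data.Fin using (Fin; zero; suc; toℕ; fromℕ; inject₁; punchIn; punchOut; fromℕ<)
    renaming (_<_ to _<ᶠ_)
  open import Data.Fin.Properties as Fin
    using (toℕ-injective; toℕ-fromℕ; toℕ-inject₁; toℕ<n; punchIn-injective; punchInᵢ≢i; punchOut-injective;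
           punchIn-punchOut; toℕ-fromℕ<; any?; injective⇒≤; suc-injective; fromℕ≢inject₁)
  open import Data.Vec as Vec using (Vec; []; _∷_; lookup; tabulate)
  open import Data.Vec.Properties using (lookup-map; lookup∘tabulate; ∷-injectiveˡ; ∷-injectiveʳ)
  open import Data.Vec.Relation.Binary.Pointwise.Extensional using (ext; Pointwise-≡⇒≡)
  open import Data.Maybe using (Maybe; just; nothing)
  open import Data.List as List using (List; []; _∷_; _++_; concatMap; length)
  open import Data.List.Properties using (length-++; length-map)
  open import Data.List.Membership.Propositional using (_∈_)
  open import Data.List.Membership.Propositional.Properties using (∈-++⁺ˡ; ∈-++⁺ʳ; ∈-++⁻; ∈-map⁺; ∈-map⁻)
  open import Data.List.Relation.Unary.Any using (here)
  open import Data.List.Relation.Unary.All as All using ([]; _∷_)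
  open import Data.List.Relation.Unary.Unique.Propositional using (Unique)
  open import Data.List.Relation.Unary.AllPairs using ([]; _∷_)
  import Data.List.Relation.Unary.Unique.Propositional.Properties as Unique
  open import Data.Product using (Σ; _×_; _,_; proj₁; proj₂)
  open import Data.Sum using (_⊎_; inj₁; inj₂; [_,_]′)
  open import Data.Unit using (tt)
  open import Data.Empty using (⊥; ⊥-elim)
  open import Function using (_∘′_; case_of_)
  open import Function.Definitions using (Injective)
  open import Function.Bundles using (_⇔_; mk⇔; Equivalence)
  open import Relation.Binary.PropositionalEquality using (_≡_; _≢_; refl; sym; trans; cong; cong₂; subst; subst₂)
  open import Relation.Nullary using (¬_; yes; no)
  open import Relation.Binary.Definitions using (tri<; tri≈; tri>)

  open Equivalence using (to; from)

  seq : ∀ {n} → Perm n → Seq n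
  seq π i = toℕ (lookup π i)

  seq-injective : ∀ {n} (π : Perm n) → IsPerm π → Injective _≡_ _≡_ (seq π)
  seq-injective π perm eq = perm (toℕ-injective eq)

  _◃_ : ∀ {n} → Fin (suc n) → Perm n → Perm (suc n)
  x ◃ τ = x ∷ Vec.map (punchIn x) τ

  ◃-isPerm : ∀ {n} (x : Fin (suc n)) {τ : Perm n} → IsPerm τ → IsPerm (x ◃ τ)
  ◃-isPerm x {τ} perm {zero} {zero} eq = refl
  ◃-isPerm x {τ} perm {zero} {suc j} eq = ⊥-elim (punchInᵢ≢i x (lookup τ j) (sym (trans eq (lookup-map j (punchIn x) τ))))
  ◃-isPerm x {τ} perm {suc i} {zero} eq = ⊥-elim (punchInᵢ≢i x (lookup τ i) (trans (sym (lookup-map i (punchIn x) τ)) eq))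
  ◃-isPerm x {τ} perm {suc i} {suc j} eq = cong suc (perm (punchIn-injective x _ _
    (trans (sym (lookup-map i (punchIn x) τ)) (trans eq (lookup-map j (punchIn x) τ)))))

  ◃-injectiveʳ : ∀ {n} (x : Fin (suc n)) {τ τ′ : Perm n} → x ◃ τ ≡ x ◃ τ′ → τ ≡ τ′
  ◃-injectiveʳ x {τ} {τ′} eq = Pointwise-≡⇒≡ (ext λ i → punchIn-injective x _ _
    (trans (sym (lookup-map i (punchIn x) τ)) (trans (cong (λ v → lookup v i) (∷-injectiveʳ eq)) (lookup-map i (punchIn x) τ′))))

  ◃-decompose : ∀ {n} x (t : Vec (Fin (suc n)) n) → IsPerm (x ∷ t) →
    Σ (Perm n) λ τ → t ≡ Vec.map (punchIn x) τ × IsPerm τ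
  ◃-decompose {n} x t perm = τ , sym map≡t , τ-perm
    where
    x≢t : ∀ i → x ≢ lookup t i
    x≢t i eq with () ← perm {zero} {suc i} eq
    τ : Perm n
    τ = tabulate (λ i → punchOut (x≢t i))
    τ-lookup : ∀ i → lookup τ i ≡ punchOut (x≢t i)
    τ-lookup = lookup∘tabulate _
    map≡t : Vec.map (punchIn x) τ ≡ t
    map≡t = Pointwise-≡⇒≡ (ext λ i →
      trans (lookup-map i (punchIn x) τ) (trans (cong (punchIn x) (τ-lookup i)) (punchIn-punchOut (x≢t i))))
    τ-perm : IsPerm τ
    τ-perm {i} {j} eq = suc-injective (perm (punchOut-injective (x≢t i) (x≢t j) (trans (sym (τ-lookup i)) (trans eq (τ-lookup j)))))

  maxFirst : ∀ {n} → Perm n → Perm (suc n)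
  maxFirst {n} = fromℕ n ◃_

  nextFirst : ∀ {c} → Perm (suc c) → Perm (suc (suc c))
  nextFirst {c} = inject₁ (fromℕ c) ◃_

  toℕ-punchIn-below : ∀ {n} (i : Fin (suc n)) (j : Fin n) → toℕ j < toℕ i → toℕ (punchIn i j) ≡ toℕ j
  toℕ-punchIn-below (suc i) zero _ = refl
  toℕ-punchIn-below (suc i) (suc j) (s≤s j<i) = cong suc (toℕ-punchIn-below i j j<i)

  toℕ-punchIn-above : ∀ {n} (i : Fin (suc n)) (j : Fin n) → toℕ i ≤ toℕ j → toℕ (punchIn i j) ≡ suc (toℕ j)
  toℕ-punchIn-above zero j _ = refl
  toℕ-punchIn-above (suc i) (suc j) (s≤s i≤j) = cong suc (toℕ-punchIn-above i j i≤j)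

  toℕ-second : ∀ c → toℕ (inject₁ (fromℕ c)) ≡ c
  toℕ-second c = trans (toℕ-inject₁ (fromℕ c)) (toℕ-fromℕ c)

  seq-maxFirst : ∀ {n} (τ : Perm n) i → seq (maxFirst τ) i ≡ (n ◂ seq τ) i
  seq-maxFirst {n} τ zero = toℕ-fromℕ n
  seq-maxFirst {n} τ (suc i) = trans (cong toℕ (lookup-map i (punchIn (fromℕ n)) τ))
    (toℕ-punchIn-below (fromℕ n) (lookup τ i) (subst (toℕ (lookup τ i) <_) (sym (toℕ-fromℕ n)) (toℕ<n (lookup τ i))))

  raised : ∀ {c} → Perm (suc c) → Seq (suc c)
  raised {c} τ i = toℕ (punchIn (inject₁ (fromℕ c)) (lookup τ i))

  seq-nextFirst : ∀ {c} (τ : Perm (suc c)) i → seq (nextFirst τ) i ≡ (c ◂ raised τ) i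
  seq-nextFirst {c} τ zero = toℕ-second c
  seq-nextFirst {c} τ (suc i) = cong toℕ (lookup-map i (punchIn (inject₁ (fromℕ c))) τ)

  raised-raise : ∀ {c} (τ : Perm (suc c)) i →
    (seq τ i < c × raised τ i ≡ seq τ i) ⊎ (seq τ i ≡ c × raised τ i ≡ suc c)
  raised-raise {c} τ i with ℕ.m≤n⇒m<n∨m≡n (ℕ.≤-pred (toℕ<n (lookup τ i)))
  ... | inj₁ τi<c = inj₁ (τi<c , toℕ-punchIn-below _ _ (subst (seq τ i <_) (sym (toℕ-second c)) τi<c))
  ... | inj₂ τi≡c = inj₂ (τi≡c , trans
    (toℕ-punchIn-above _ _ (subst (_≤ seq τ i) (sym (toℕ-second c)) (ℕ.≤-reflexive (sym τi≡c))))
    (cong suc τi≡c))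

  avoidsAll-maxFirst : ∀ {n} (τ : Perm n) E →
    AvoidsAll (seq (maxFirst τ)) n E ⇔ AvoidsAll (seq τ) (pred n) (concatMap ∂max E)
  avoidsAll-maxFirst τ = avoidsAll-derivative
    (isDerivative-cong (seq-maxFirst τ) (MaxFirst.isDerivative (seq τ) (λ i → toℕ<n (lookup τ i)) _))

  avoidsAll-nextFirst : ∀ {c} (τ : Perm (suc c)) E →
    AvoidsAll (seq (nextFirst τ)) (suc c) E ⇔ AvoidsAll (seq τ) c (concatMap ∂next E)
  avoidsAll-nextFirst τ = avoidsAll-derivative
    (isDerivative-cong (seq-nextFirst τ) (NextFirst.isDerivative (seq τ) (raised τ) (raised-raise τ)))

  isPerm-surjective : ∀ {n} (π : Perm n) → IsPerm π → ∀ y → Σ (Fin n) λ i → lookup π i ≡ y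
  isPerm-surjective {suc m} π perm y with any? (λ i → lookup π i Fin.≟ y)
  ... | yes hit = hit
  ... | no miss = ⊥-elim (<-irrefl refl (injective⇒≤ {f = squeeze} λ {i} {j} eq → perm (punchOut-injective (y≢ i) (y≢ j) eq)))
    where
    y≢ : ∀ i → y ≢ lookup π i
    y≢ i eq = miss (i , sym eq)
    squeeze : Fin (suc m) → Fin m
    squeeze i = punchOut (y≢ i)

  occurs-shifted : ∀ {m k} (P : Seq m) K (vs : Vec ℕ k) (f : Fin k → Fin m) a → Increasing f →
    (∀ i → P (f i) ≡ a + lookup vs i) → Occurs P K (plain vs)
  occurs-shifted P K vs f a f↑ eq = f , (f↑ , λ i j → subst₂ (λ u v → (u < v) ⇔ _) (sym (eq i)) (sym (eq j))
    (mk⇔ (+-cancelˡ-< a _ _) (+-monoʳ-< a))) , tt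

  increasing₃ : ∀ {N} {a b c : Fin N} → a <ᶠ b → b <ᶠ c → Increasing (lookup (a ∷ b ∷ c ∷ []))
  increasing₃ a<b b<c zero (suc zero) _ = a<b
  increasing₃ a<b b<c zero (suc (suc zero)) _ = ℕ.<-trans a<b b<c
  increasing₃ a<b b<c (suc zero) (suc (suc zero)) _ = b<c
  increasing₃ a<b b<c zero zero ()
  increasing₃ a<b b<c (suc zero) zero ()
  increasing₃ a<b b<c (suc zero) (suc zero) (s≤s ())
  increasing₃ a<b b<c (suc (suc zero)) zero ()
  increasing₃ a<b b<c (suc (suc zero)) (suc zero) (s≤s ())
  increasing₃ a<b b<c (suc (suc zero)) (suc (suc zero)) (s≤s (s≤s ()))

  -- If x + 1 and x + 2 both follow the first entry x, they form a 123 or a 132 with it.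
  first≥n-1 : ∀ {n} (π : Perm (suc n)) K → IsPerm π →
    ¬ Occurs (seq π) K (plain p123) → ¬ Occurs (seq π) K (plain p132) → n ≤ suc (seq π zero)
  first≥n-1 {n} π K perm ¬123 ¬132 with n ≤? suc (seq π zero)
  ... | yes n≤1+x = n≤1+x
  ... | no n≰1+x = ⊥-elim (contradiction (proj₁ at+1) (proj₁ at+2) seq-at+1 seq-at+2)
    where
    x : ℕ
    x = seq π zero
    x+2<1+n : suc (suc x) < suc n
    x+2<1+n = s≤s (≰⇒> n≰1+x)
    x+1<1+n : suc x < suc n
    x+1<1+n = ℕ.<-trans ≤-refl x+2<1+n
    at+1 : Σ (Fin (suc n)) λ i → lookup π i ≡ fromℕ< x+1<1+n
    at+1 = isPerm-surjective π perm (fromℕ< x+1<1+n)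
    at+2 : Σ (Fin (suc n)) λ i → lookup π i ≡ fromℕ< x+2<1+n
    at+2 = isPerm-surjective π perm (fromℕ< x+2<1+n)
    seq-at+1 : seq π (proj₁ at+1) ≡ x + 1
    seq-at+1 = trans (cong toℕ (proj₂ at+1)) (trans (toℕ-fromℕ< x+1<1+n) (ℕ.+-comm 1 x))
    seq-at+2 : seq π (proj₁ at+2) ≡ x + 2
    seq-at+2 = trans (cong toℕ (proj₂ at+2)) (trans (toℕ-fromℕ< x+2<1+n) (ℕ.+-comm 2 x))
    contradiction : ∀ a b → seq π a ≡ x + 1 → seq π b ≡ x + 2 → ⊥
    contradiction zero _ eq _ = <-irrefl (trans eq (ℕ.+-comm x 1)) ≤-refl
    contradiction (suc a) zero _ eq = <-irrefl (trans eq (ℕ.+-comm x 2)) (ℕ.m<n+m x (s≤s z≤n))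
    contradiction (suc a) (suc b) eqa eqb with Fin.<-cmp a b
    ... | tri< a<b _ _ = ¬123 (occurs-shifted (seq π) K p123 (lookup (zero ∷ suc a ∷ suc b ∷ [])) x
          (increasing₃ (s≤s z≤n) (s≤s a<b))
          λ { zero → sym (ℕ.+-identityʳ x) ; (suc zero) → eqa ; (suc (suc zero)) → eqb })
    ... | tri≈ _ refl _ = <-irrefl (trans (sym eqa) eqb) (+-monoʳ-< x (ℕ.n<1+n 1))
    ... | tri> _ _ b<a = ¬132 (occurs-shifted (seq π) K p132 (lookup (zero ∷ suc b ∷ suc a ∷ [])) x
          (increasing₃ (s≤s z≤n) (s≤s b<a))
          λ { zero → sym (ℕ.+-identityʳ x) ; (suc zero) → eqb ; (suc (suc zero)) → eqa })

  data TopTwo : ∀ {n} → Fin (suc n) → Set where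
    largest : ∀ {n} → TopTwo (fromℕ n)
    second : ∀ {c} → TopTwo (inject₁ (fromℕ c))

  topTwo : ∀ {n} (x : Fin (suc n)) → n ≤ suc (toℕ x) → TopTwo x
  topTwo {zero} zero _ = largest
  topTwo {suc zero} zero _ = second
  topTwo {suc (suc n)} zero (s≤s ())
  topTwo {suc n} (suc x) (s≤s n≤1+x) with topTwo x n≤1+x
  ... | largest = largest
  ... | second = second

  data FirstLetter : ∀ {n} → Perm (suc n) → Set where
    max : ∀ {n} (τ : Perm n) → IsPerm τ → FirstLetter (maxFirst τ)
    next : ∀ {c} (τ : Perm (suc c)) → IsPerm τ → FirstLetter (nextFirst τ)

  firstLetter : ∀ {n} (π : Perm (suc n)) K → IsPerm π →
    ¬ Occurs (seq π) K (plain p123) → ¬ Occurs (seq π) K (plain p132) → FirstLetter π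
  firstLetter π@(x ∷ t) K perm ¬123 ¬132
    with ◃-decompose x t perm | topTwo x (first≥n-1 π K perm ¬123 ¬132)
  ... | τ , refl , τ-perm | largest = max τ τ-perm
  ... | τ , refl , τ-perm | second = next τ τ-perm

  mutual
    enumerate : State → (n : ℕ) → List (Perm n)
    enumerate s zero = [] ∷ []
    enumerate s (suc n) = List.map maxFirst (enumerateFrom (afterMax s) n) ++ nextFirsts (afterNext s) n

    enumerateFrom : Maybe State → (n : ℕ) → List (Perm n)
    enumerateFrom nothing n = []
    enumerateFrom (just s) n = enumerate s n

    nextFirsts : Maybe State → (n : ℕ) → List (Perm (suc n))
    nextFirsts t zero = []
    nextFirsts t (suc c) = List.map nextFirst (enumerateFrom t (suc c))

  mutual
    count : State → ℕ → ℕ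
    count s zero = 1
    count s (suc n) = countFrom (afterMax s) n + countNextFirsts (afterNext s) n

    countFrom : Maybe State → ℕ → ℕ
    countFrom nothing n = 0
    countFrom (just s) n = count s n

    countNextFirsts : Maybe State → ℕ → ℕ
    countNextFirsts t zero = 0
    countNextFirsts t (suc c) = countFrom t (suc c)

  mutual
    length-enumerate : ∀ s n → length (enumerate s n) ≡ count s n
    length-enumerate s zero = refl
    length-enumerate s (suc n) = trans (length-++ (List.map maxFirst (enumerateFrom (afterMax s) n)))
      (cong₂ _+_ (trans (length-map maxFirst (enumerateFrom (afterMax s) n)) (length-enumerateFrom (afterMax s) n))
                 (length-nextFirsts (afterNext s) n))

    length-enumerateFrom : ∀ t n → length (enumerateFrom t n) ≡ countFrom t n
    length-enumerateFrom nothing n = refl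
    length-enumerateFrom (just s) n = length-enumerate s n

    length-nextFirsts : ∀ t n → length (nextFirsts t n) ≡ countNextFirsts t n
    length-nextFirsts t zero = refl
    length-nextFirsts t (suc c) = trans (length-map nextFirst (enumerateFrom t (suc c))) (length-enumerateFrom t (suc c))

  mutual
    unique-enumerate : ∀ s n → Unique (enumerate s n)
    unique-enumerate s zero = [] ∷ []
    unique-enumerate s (suc n) = Unique.++⁺ (Unique.map⁺ (◃-injectiveʳ (fromℕ n)) (unique-enumerateFrom (afterMax s) n))
      (unique-nextFirsts (afterNext s) n) (maxFirst≢nextFirst (afterMax s) (afterNext s) n)

    unique-enumerateFrom : ∀ t n → Unique (enumerateFrom t n)
    unique-enumerateFrom nothing n = []
    unique-enumerateFrom (just s) n = unique-enumerate s n

    unique-nextFirsts : ∀ t n → Unique (nextFirsts t n)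
    unique-nextFirsts t zero = []
    unique-nextFirsts t (suc c) = Unique.map⁺ (◃-injectiveʳ (inject₁ (fromℕ c))) (unique-enumerateFrom t (suc c))

    maxFirst≢nextFirst : ∀ t t′ n {π} → ¬ (π ∈ List.map maxFirst (enumerateFrom t n) × π ∈ nextFirsts t′ n)
    maxFirst≢nextFirst t t′ (suc c) (mem , mem′) with ∈-map⁻ maxFirst mem | ∈-map⁻ nextFirst mem′
    ... | _ , _ , refl | _ , _ , eq = fromℕ≢inject₁ (∷-injectiveˡ eq)

  Accepts : ∀ {n} → State → Perm n → Set
  Accepts {n} s π = IsPerm π × AvoidsAll (seq π) (pred n) (patterns s)

  EnumerationCorrect : ℕ → Set
  EnumerationCorrect n = ∀ s (π : Perm n) → Accepts s π ⇔ π ∈ enumerate s n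

  module _ {m} {∂ : MarkedPattern → List MarkedPattern} (correct : EnumerationCorrect m) where

    transition-sound : ∀ s t → Transition ∂ s t → ∀ {τ : Perm m} → τ ∈ enumerateFrom t m →
      IsPerm τ × AvoidsAll (seq τ) (pred m) (concatMap ∂ (patterns s))
    transition-sound s (just s′) (_ , covers) {τ} mem =
      let (perm , av) = from (correct s′ τ) mem in perm , avoidsAll-covered (seq-injective τ perm) covers av

    transition-complete : ∀ s t → Transition ∂ s t → ∀ {τ : Perm m} → IsPerm τ →
      AvoidsAll (seq τ) (pred m) (concatMap ∂ (patterns s)) → τ ∈ enumerateFrom t m
    transition-complete s (just s′) (covers , _) {τ} perm av =
      to (correct s′ τ) (perm , avoidsAll-covered (seq-injective τ perm) covers av)
    transition-complete s nothing empty perm av = ⊥-elim (¬avoidsAll-empty empty av)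

  accepts-maxFirst : ∀ {n} s {τ : Perm n} → IsPerm τ →
    Accepts s (maxFirst τ) ⇔ AvoidsAll (seq τ) (pred n) (concatMap ∂max (patterns s))
  accepts-maxFirst s {τ} perm = mk⇔ (to (avoidsAll-maxFirst τ _) ∘′ proj₂) accepts
    where
    accepts : AvoidsAll (seq τ) _ (concatMap ∂max (patterns s)) → Accepts s (maxFirst τ)
    accepts av = ◃-isPerm _ perm , from (avoidsAll-maxFirst τ _) av

  accepts-nextFirst : ∀ {c} s {τ : Perm (suc c)} → IsPerm τ →
    Accepts s (nextFirst τ) ⇔ AvoidsAll (seq τ) c (concatMap ∂next (patterns s))
  accepts-nextFirst s {τ} perm = mk⇔ (to (avoidsAll-nextFirst τ _) ∘′ proj₂) accepts
    where
    accepts : AvoidsAll (seq τ) _ (concatMap ∂next (patterns s)) → Accepts s (nextFirst τ)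
    accepts av = ◃-isPerm _ perm , from (avoidsAll-nextFirst τ _) av

  ¬occurs-nonempty : ∀ {P : Seq 0} {K} e → ¬ IsEmpty e → ¬ Occurs P K e
  ¬occurs-nonempty (zero , _) nonempty _ = nonempty refl
  ¬occurs-nonempty (suc k , _) _ (f , _) with () ← f zero

  maxFirsts-sound : ∀ {n} s → EnumerationCorrect n →
    ∀ {π} → π ∈ List.map maxFirst (enumerateFrom (afterMax s) n) → Accepts s π
  maxFirsts-sound s correct mem with ∈-map⁻ maxFirst mem
  ... | τ , τ∈ , refl =
    let (τ-perm , av) = transition-sound correct s (afterMax s) (transition-afterMax s) τ∈ in
    from (accepts-maxFirst s τ-perm) av

  nextFirsts-sound : ∀ {n} s → EnumerationCorrect n → ∀ {π} → π ∈ nextFirsts (afterNext s) n → Accepts s π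
  nextFirsts-sound {suc c} s correct mem with ∈-map⁻ nextFirst mem
  ... | τ , τ∈ , refl =
    let (τ-perm , av) = transition-sound correct s (afterNext s) (transition-afterNext s) τ∈ in
    from (accepts-nextFirst s τ-perm) av

  enumeration-correct : ∀ n → EnumerationCorrect n
  enumeration-correct zero s [] =
    mk⇔ (λ _ → here refl) (λ _ → (λ {i} → case i of λ ()) , All.map (λ {e} → ¬occurs-nonempty e) (nonempty s))
  enumeration-correct (suc n) s π = mk⇔ complete sound
    where
    correct : EnumerationCorrect n
    correct = enumeration-correct n

    complete : Accepts s π → π ∈ enumerate s (suc n)
    complete acc@(perm , ¬123 ∷ ¬132 ∷ _) with firstLetter π n perm ¬123 ¬132
    ... | max τ τ-perm = ∈-++⁺ˡ (∈-map⁺ maxFirst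
          (transition-complete correct s (afterMax s) (transition-afterMax s) τ-perm (to (accepts-maxFirst s τ-perm) acc)))
    ... | next τ τ-perm = ∈-++⁺ʳ _ (∈-map⁺ nextFirst
          (transition-complete correct s (afterNext s) (transition-afterNext s) τ-perm (to (accepts-nextFirst s τ-perm) acc)))

    sound : π ∈ enumerate s (suc n) → Accepts s π
    sound mem = [ maxFirsts-sound s correct , nextFirsts-sound s correct ]′ (∈-++⁻ _ mem)

module Counting where
  open import Defs using (F)
  open Automaton using (q0; q3; q4; q5; q6; q7; q8; q9)
  open Enumeration using (count)
  open import Data.Nat as ℕ using (ℕ; zero; suc)
  open import Data.Integer using (ℤ; +_; -_; _+_; _-_; _*_)
  open import Data.Integer.Properties using (pos-+)
  open import Data.Integer.Tactic.RingSolver using (solve-∀)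
  open import Relation.Binary.PropositionalEquality using (_≡_; refl; sym; trans; cong; cong₂; module ≡-Reasoning)
  open ≡-Reasoning

  -- The counts are eventually of the form a F(n+1) + b F(n) + c n + d; such sequences are closed
  -- under pointwise sums and under shifting n.
  record FibAffine : Set where
    constructor ⟨_,_,_,_⟩
    field a b c d : ℤ

  ⟦_⟧ : FibAffine → ℕ → ℤ
  ⟦ ⟨ a , b , c , d ⟩ ⟧ n = a * + F (suc n) + b * + F n + c * + n + d

  infixl 6 _⊞_
  _⊞_ : FibAffine → FibAffine → FibAffine
  ⟨ a , b , c , d ⟩ ⊞ ⟨ a′ , b′ , c′ , d′ ⟩ = ⟨ a + a′ , b + b′ , c + c′ , d + d′ ⟩

  shift : FibAffine → FibAffine
  shift ⟨ a , b , c , d ⟩ = ⟨ a + b , a , c , c + d ⟩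

  ⟦⟧-⊞ : ∀ A B n → ⟦ A ⟧ n + ⟦ B ⟧ n ≡ ⟦ A ⊞ B ⟧ n
  ⟦⟧-⊞ ⟨ a , b , c , d ⟩ ⟨ a′ , b′ , c′ , d′ ⟩ n = algebra a b c d a′ b′ c′ d′ (+ F (suc n)) (+ F n) (+ n)
    where
    algebra : ∀ a b c d a′ b′ c′ d′ f₁ f₀ m →
      (a * f₁ + b * f₀ + c * m + d) + (a′ * f₁ + b′ * f₀ + c′ * m + d′) ≡
      (a + a′) * f₁ + (b + b′) * f₀ + (c + c′) * m + (d + d′)
    algebra = solve-∀

  ⟦⟧-suc : ∀ A n → ⟦ A ⟧ (suc n) ≡ ⟦ shift A ⟧ n
  ⟦⟧-suc ⟨ a , b , c , d ⟩ n = begin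
    a * + F (suc (suc n)) + b * + F (suc n) + c * + suc n + d
      ≡⟨ cong₂ (λ f₂ m → a * f₂ + b * + F (suc n) + c * m + d) (pos-+ (F (suc n)) (F n)) (pos-+ 1 n) ⟩
    a * (+ F (suc n) + + F n) + b * + F (suc n) + c * (+ 1 + + n) + d
      ≡⟨ algebra a b c d (+ F (suc n)) (+ F n) (+ n) ⟩
    (a + b) * + F (suc n) + a * + F n + c * + n + (c + d) ∎
    where
    algebra : ∀ a b c d f₁ f₀ m →
      a * (f₁ + f₀) + b * f₁ + c * (+ 1 + m) + d ≡ (a + b) * f₁ + a * f₀ + c * m + (c + d)
    algebra = solve-∀

  +-sum : ∀ A B n {x y : ℕ} → + x ≡ ⟦ A ⟧ n → + y ≡ ⟦ B ⟧ n → + (x ℕ.+ y) ≡ ⟦ A ⊞ B ⟧ n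
  +-sum A B n {x} {y} x≡ y≡ = trans (pos-+ x y) (trans (cong₂ _+_ x≡ y≡) (⟦⟧-⊞ A B n))

  count-q9 : ∀ k → count q9 (suc k) ≡ 0
  count-q9 zero = refl
  count-q9 (suc k) = refl

  count-q8 : ∀ k → count q8 (3 ℕ.+ k) ≡ 0
  count-q8 k rewrite count-q9 (suc k) | count-q9 k = refl

  count-q7 : ∀ k → count q7 (3 ℕ.+ k) ≡ 3
  count-q7 zero = refl
  count-q7 (suc k) = cong₂ ℕ._+_ (count-q8 k) (count-q7 k)

  q3-form q6-form q7-form : FibAffine
  q3-form = ⟨ + 1 , + 2 , + 0 , - + 3 ⟩
  q6-form = ⟨ + 2 , - + 1 , + 0 , + 0 ⟩
  q7-form = ⟨ + 0 , + 0 , + 0 , + 3 ⟩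

  mutual
    count-q3 : ∀ k → + count q3 (3 ℕ.+ k) ≡ ⟦ q3-form ⟧ (3 ℕ.+ k)
    count-q3 zero = refl
    count-q3 (suc k) = trans (+-sum q3-form q6-form (3 ℕ.+ k) (count-q3 k) (count-q6 k)) (sym (⟦⟧-suc q3-form (3 ℕ.+ k)))

    count-q6 : ∀ k → + count q6 (3 ℕ.+ k) ≡ ⟦ q6-form ⟧ (3 ℕ.+ k)
    count-q6 zero = refl
    count-q6 (suc k) = trans (+-sum q3-form q7-form (3 ℕ.+ k) (count-q3 k) (cong +_ (count-q7 k))) (sym (⟦⟧-suc q6-form (3 ℕ.+ k)))

  q4-form : FibAffine
  q4-form = ⟨ + 3 , + 1 , - + 3 , + 2 ⟩

  count-accumulating : ∀ s → (∀ n → count s (suc (suc n)) ≡ count q3 (suc n) ℕ.+ count s (suc n)) → count s 3 ≡ 4 →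
    ∀ k → + count s (3 ℕ.+ k) ≡ ⟦ q4-form ⟧ (3 ℕ.+ k)
  count-accumulating s rec base zero = cong +_ base
  count-accumulating s rec base (suc k) = begin
    + count s (4 ℕ.+ k)
      ≡⟨ cong +_ (rec (2 ℕ.+ k)) ⟩
    + (count q3 (3 ℕ.+ k) ℕ.+ count s (3 ℕ.+ k))
      ≡⟨ +-sum q3-form q4-form (3 ℕ.+ k) (count-q3 k) (count-accumulating s rec base k) ⟩
    ⟦ shift q4-form ⟧ (3 ℕ.+ k)
      ≡⟨ ⟦⟧-suc q4-form (3 ℕ.+ k) ⟨
    ⟦ q4-form ⟧ (4 ℕ.+ k) ∎

  count-q4 : ∀ k → + count q4 (3 ℕ.+ k) ≡ ⟦ q4-form ⟧ (3 ℕ.+ k)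
  count-q4 = count-accumulating q4 (λ _ → refl) refl

  count-q5 : ∀ k → + count q5 (3 ℕ.+ k) ≡ ⟦ q4-form ⟧ (3 ℕ.+ k)
  count-q5 = count-accumulating q5 (λ _ → refl) refl

  q0-form : FibAffine
  q0-form = ⟨ + 5 , + 0 , - + 9 , + 21 ⟩

  -- count q0 (n + 2) unfolds to count q4 (n + 1) + (count q4 n + count q5 n), because q1 and q4
  -- have the same successors.
  count-q0 : ∀ k → + count q0 (5 ℕ.+ k) ≡ ⟦ q0-form ⟧ (5 ℕ.+ k)
  count-q0 k = begin
    + count q0 (5 ℕ.+ k)
      ≡⟨ +-sum (shift q4-form) (q4-form ⊞ q4-form) (3 ℕ.+ k)
           (trans (count-q4 (suc k)) (⟦⟧-suc q4-form (3 ℕ.+ k)))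
           (+-sum q4-form q4-form (3 ℕ.+ k) (count-q4 k) (count-q5 k)) ⟩
    ⟦ shift (shift q0-form) ⟧ (3 ℕ.+ k)  ≡⟨ ⟦⟧-suc (shift q0-form) (3 ℕ.+ k) ⟨
    ⟦ shift q0-form ⟧ (4 ℕ.+ k)          ≡⟨ ⟦⟧-suc q0-form (4 ℕ.+ k) ⟨
    ⟦ q0-form ⟧ (5 ℕ.+ k)                ∎

  ⟦q0-form⟧ : ∀ n → ⟦ q0-form ⟧ n ≡ + 5 * + F (suc n) - + 9 * + n + + 21
  ⟦q0-form⟧ n = algebra (+ F (suc n)) (+ F n) (+ n)
    where
    algebra : ∀ f₁ f₀ m → + 5 * f₁ + + 0 * f₀ + - + 9 * m + + 21 ≡ + 5 * f₁ - + 9 * m + + 21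
    algebra = solve-∀

module GeneratingFunction where
  open import Defs using (F; FPS; poly; _⊕_; conv; _⊛_)
  open Automaton using (q0)
  open Enumeration using (count)
  open Counting
  open import Data.Nat as ℕ using (ℕ; zero; suc; _≤_; z≤n; s≤s)
  open import Data.Nat.Properties using (≤-refl; ≤-trans; n≤1+n; m≤m+n; +-identityʳ; +-suc)
  open import Data.Integer using (ℤ; +_; -_; _+_; _*_)
  open import Data.Integer.Properties as ℤ using ()
  open import Data.Integer.Tactic.RingSolver using (solve-∀)
  open import Data.List using ([]; _∷_)
  open import Relation.Binary.PropositionalEquality using (_≡_; refl; trans; cong; cong₂; module ≡-Reasoning)
  open ≡-Reasoning

  -- conv f g i m = f i * g m + f (i - 1) * g (m + 1) + ... + f 0 * g (m + i)
  conv-cong : ∀ f {g g′} i m → (∀ j → m ≤ j → g j ≡ g′ j) → conv f g i m ≡ conv f g′ i m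
  conv-cong f zero m g≡g′ = cong (f zero *_) (g≡g′ m ≤-refl)
  conv-cong f (suc i) m g≡g′ =
    cong₂ _+_ (cong (f (suc i) *_) (g≡g′ m ≤-refl)) (conv-cong f i (suc m) λ j m<j → g≡g′ j (≤-trans (n≤1+n m) m<j))

  conv-beyondDegree : ∀ f g d → (∀ j → f (suc (d ℕ.+ j)) ≡ + 0) →
    ∀ k m → conv f g (d ℕ.+ k) m ≡ conv f g d (k ℕ.+ m)
  conv-beyondDegree f g d f≡0 zero m rewrite +-identityʳ d = refl
  conv-beyondDegree f g d f≡0 (suc k) m rewrite +-suc d k | f≡0 k =
    trans (ℤ.+-identityˡ _) (trans (conv-beyondDegree f g d f≡0 k (suc m)) (cong (conv f g d) (+-suc k m)))

  denominator : FPS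
  denominator = (poly (+ 1 ∷ - + 1 ∷ []) ⊛ poly (+ 1 ∷ - + 1 ∷ [])) ⊛ poly (+ 1 ∷ - + 1 ∷ - + 1 ∷ [])

  denominator-degree : ∀ j → denominator (5 ℕ.+ j) ≡ + 0
  denominator-degree j = conv-beyondDegree square _ 2 square-degree (3 ℕ.+ j) 0
    where
    square : FPS
    square = poly (+ 1 ∷ - + 1 ∷ []) ⊛ poly (+ 1 ∷ - + 1 ∷ [])
    square-degree : ∀ j → square (3 ℕ.+ j) ≡ + 0
    square-degree j = conv-beyondDegree (poly (+ 1 ∷ - + 1 ∷ [])) _ 1 (λ _ → refl) (2 ℕ.+ j) 0

  infixr 7 _·_
  _·_ : ℤ → FibAffine → FibAffine
  k · ⟨ a , b , c , d ⟩ = ⟨ k * a , k * b , k * c , k * d ⟩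

  ⟦⟧-· : ∀ k A n → k * ⟦ A ⟧ n ≡ ⟦ k · A ⟧ n
  ⟦⟧-· k ⟨ a , b , c , d ⟩ n = algebra k a b c d (+ F (suc n)) (+ F n) (+ n)
    where
    algebra : ∀ k a b c d f₁ f₀ m → k * (a * f₁ + b * f₀ + c * m + d) ≡ k * a * f₁ + k * b * f₀ + k * c * m + k * d
    algebra = solve-∀

  convolve : FPS → ℕ → FibAffine → FibAffine
  convolve f zero A = f zero · A
  convolve f (suc i) A = f (suc i) · A ⊞ shift (convolve f i A)

  conv-fibAffine : ∀ f i A m → conv f ⟦ A ⟧ i m ≡ ⟦ convolve f i A ⟧ m
  conv-fibAffine f zero A m = ⟦⟧-· (f zero) A m
  conv-fibAffine f (suc i) A m = begin
    f (suc i) * ⟦ A ⟧ m + conv f ⟦ A ⟧ i (suc m)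
      ≡⟨ cong₂ _+_ (⟦⟧-· (f (suc i)) A m) (trans (conv-fibAffine f i A (suc m)) (⟦⟧-suc (convolve f i A) m)) ⟩
    ⟦ f (suc i) · A ⟧ m + ⟦ shift (convolve f i A) ⟧ m
      ≡⟨ ⟦⟧-⊞ (f (suc i) · A) (shift (convolve f i A)) m ⟩
    ⟦ convolve f (suc i) A ⟧ m ∎

  denominator-annihilates-q0 : ∀ n → conv denominator ⟦ q0-form ⟧ 4 n ≡ + 0
  denominator-annihilates-q0 = conv-fibAffine denominator 4 q0-form

  counts : FPS
  counts n = + count q0 n

  correctedCounts : FPS
  correctedCounts = counts ⊕ poly (+ 25 ∷ + 16 ∷ + 11 ∷ + 5 ∷ + 2 ∷ [])

  correctedCounts-tail : ∀ j → 5 ≤ j → correctedCounts j ≡ ⟦ q0-form ⟧ j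
  correctedCounts-tail (suc (suc (suc (suc (suc k))))) (s≤s (s≤s (s≤s (s≤s (s≤s z≤n))))) =
    trans (ℤ.+-identityʳ _) (count-q0 k)

  generatingFunction : ∀ m → (denominator ⊛ correctedCounts) m ≡ poly (+ 26 ∷ - + 61 ∷ + 14 ∷ + 30 ∷ []) m
  generatingFunction 0 = refl
  generatingFunction 1 = refl
  generatingFunction 2 = refl
  generatingFunction 3 = refl
  generatingFunction 4 = refl
  generatingFunction 5 = refl
  generatingFunction 6 = refl
  generatingFunction 7 = refl
  generatingFunction 8 = refl
  generatingFunction (suc (suc (suc (suc (suc (suc (suc (suc (suc k))))))))) = begin
    conv denominator correctedCounts (4 ℕ.+ (5 ℕ.+ k)) 0
      ≡⟨ conv-beyondDegree denominator correctedCounts 4 denominator-degree (5 ℕ.+ k) 0 ⟩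
    conv denominator correctedCounts 4 (5 ℕ.+ k ℕ.+ 0)
      ≡⟨ cong (conv denominator correctedCounts 4) (+-identityʳ (5 ℕ.+ k)) ⟩
    conv denominator correctedCounts 4 (5 ℕ.+ k)
      ≡⟨ conv-cong denominator 4 (5 ℕ.+ k) (λ j 5+k≤j → correctedCounts-tail j (≤-trans (m≤m+n 5 k) 5+k≤j)) ⟩
    conv denominator ⟦ q0-form ⟧ 4 (5 ℕ.+ k)
      ≡⟨ denominator-annihilates-q0 (5 ℕ.+ k) ⟩
    + 0 ∎

module Correspondence where
  open import Defs
  open Occurrences using (Occurs)
  open Derivatives using (plain)
  open Automaton using (q0)
  open Enumeration using (seq; Accepts; enumerate; count; enumeration-correct; unique-enumerate; length-enumerate)
  open import Data.Nat using (_<_; pred)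
  open import Data.Fin using (toℕ)
  open import Data.Vec as Vec using (lookup)
  open import Data.Vec.Properties using (lookup-map)
  open import Data.List.Relation.Unary.All using ([]; _∷_)
  open import Data.List.Membership.Propositional.Properties.WithK using (unique∧set⇒bag)
  open import Data.List.Relation.Binary.BagAndSetEquality using (∼bag⇒↭)
  open import Data.List.Relation.Binary.Permutation.Propositional.Properties using (↭-length)
  open import Data.Product using (_,_; proj₂)
  open import Relation.Nullary using (¬_)
  open import Function.Bundles using (_⇔_; mk⇔; Equivalence)
  import Function.Properties.Equivalence as ⇔
  open import Relation.Binary.PropositionalEquality using (_≡_; refl; sym; subst₂)

  open Equivalence using (to; from)

  contains⇔occurs : ∀ {n k} (π : Perm n) (σ : Perm k) K → Contains π σ ⇔ Occurs (seq π) K (plain (Vec.map toℕ σ))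
  contains⇔occurs π σ K = mk⇔
    (λ (f , f↑ , order) → f , (f↑ , λ i j → ⇔.trans (order i j) (lookup-map-order i j)) , _)
    (λ (f , (f↑ , order) , _) → f , f↑ , λ i j → ⇔.trans (order i j) (⇔.sym (lookup-map-order i j)))
    where
    lookup-map-order : ∀ i j → (lookup σ i Data.Fin.< lookup σ j) ⇔ (lookup (Vec.map toℕ σ) i < lookup (Vec.map toℕ σ) j)
    lookup-map-order i j = subst₂ (λ a b → (lookup σ i Data.Fin.< lookup σ j) ⇔ (a < b))
      (sym (lookup-map i toℕ σ)) (sym (lookup-map j toℕ σ)) ⇔.refl

  inS⇔accepts : ∀ {n} (π : Perm n) → InS R π ⇔ Accepts q0 π
  inS⇔accepts {n} π = mk⇔
    (λ { (perm , ¬132 ∷ ¬123 ∷ ¬γ ∷ []) → perm , avoid p123 ¬123 ∷ avoid p132 ¬132 ∷ avoid γ222 ¬γ ∷ [] })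
    (λ { (perm , ¬123 ∷ ¬132 ∷ ¬γ ∷ []) → perm , contain p132 ¬132 ∷ contain p123 ¬123 ∷ contain γ222 ¬γ ∷ [] })
    where
    avoid : ∀ p → Avoids π (proj₂ p) → ¬ Occurs (seq π) (pred n) (plain (Vec.map toℕ (proj₂ p)))
    avoid (_ , σ) ¬σ occ = ¬σ (from (contains⇔occurs π σ (pred n)) occ)
    contain : ∀ p → ¬ Occurs (seq π) (pred n) (plain (Vec.map toℕ (proj₂ p))) → Avoids π (proj₂ p)
    contain (_ , σ) ¬occ c = ¬occ (to (contains⇔occurs π σ (pred n)) c)

  hasCard-count : ∀ n → HasCard (InS {n} R) (count q0 n)
  hasCard-count n = enumerate q0 n , unique-enumerate q0 n ,
    (λ π → ⇔.sym (⇔.trans (inS⇔accepts π) (enumeration-correct n q0 π))) , length-enumerate q0 n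

  hasCard-unique : ∀ {A : Set} {P : A → Set} {k₁ k₂} → HasCard P k₁ → HasCard P k₂ → k₁ ≡ k₂
  hasCard-unique (L₁ , unique₁ , ∈⇔₁ , refl) (L₂ , unique₂ , ∈⇔₂ , refl) =
    ↭-length (∼bag⇒↭ (unique∧set⇒bag unique₁ unique₂ (λ {x} → ⇔.trans (∈⇔₁ x) (⇔.sym (∈⇔₂ x)))))

open import Defs
open import Data.Nat using (ℕ; suc; _≤_; z≤n; s≤s)
open import Data.Integer using (+_; -_; _+_; _-_; _*_)
open import Data.List using ([]; _∷_)
open import Data.Product using (Σ; _×_; _,_)
open import Relation.Binary.PropositionalEquality using (_≡_; trans; cong)
open Automaton using (q0)
open Enumeration using (count)
open Counting using (count-q0; ⟦q0-form⟧)
open GeneratingFunction using (conv-cong; denominator; generatingFunction)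
open Correspondence using (hasCard-count; hasCard-unique)

mainTheorem12 :
    (∀ n → 5 ≤ n → Σ ℕ λ k → HasCard (InS {n} R) k × (+ k ≡ + 5 * + F (suc n) - + 9 * + n + + 21))
    × (∀ (a : ℕ → ℕ) → (∀ n → HasCard (InS {n} R) (a n)) →
        ∀ m → (((poly (+ 1 ∷ - + 1 ∷ []) ⊛ poly (+ 1 ∷ - + 1 ∷ [])) ⊛ poly (+ 1 ∷ - + 1 ∷ - + 1 ∷ []))
                ⊛ ((λ n → + a n) ⊕ poly (+ 25 ∷ + 16 ∷ + 11 ∷ + 5 ∷ + 2 ∷ []))) m
              ≡ poly (+ 26 ∷ - + 61 ∷ + 14 ∷ + 30 ∷ []) m)
mainTheorem12 = cardinality , series
  where
  cardinality : ∀ n → 5 ≤ n → Σ ℕ λ k → HasCard (InS {n} R) k × (+ k ≡ + 5 * + F (suc n) - + 9 * + n + + 21)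
  cardinality n@(suc (suc (suc (suc (suc k))))) (s≤s (s≤s (s≤s (s≤s (s≤s z≤n))))) =
    count q0 n , hasCard-count n , trans (count-q0 k) (⟦q0-form⟧ n)

  series : ∀ (a : ℕ → ℕ) → (∀ n → HasCard (InS {n} R) (a n)) →
    ∀ m → (denominator ⊛ ((λ n → + a n) ⊕ poly (+ 25 ∷ + 16 ∷ + 11 ∷ + 5 ∷ + 2 ∷ []))) m
          ≡ poly (+ 26 ∷ - + 61 ∷ + 14 ∷ + 30 ∷ []) m
  series a hasCard m = trans
    (conv-cong denominator m 0 λ n _ → cong (λ k → + k + poly (+ 25 ∷ + 16 ∷ + 11 ∷ + 5 ∷ + 2 ∷ []) n)
      (hasCard-unique (hasCard n) (hasCard-count n)))
    (generatingFunction m)
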